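{- Let $\mathcal{G}$ be a finite simple undirected graph and let $H_1$, $H_2$ be induced subgraphs of $\mathcal{G}$. Then $H_1$ and $H_2$ are T-twins in $\mathcal{G}$ if and only if $\overline{H_1}$ and $\overline{H_2}$ are F-twins in $\overline{\mathcal{G}}$; and $H_1$ and $H_2$ are F-twins in $\mathcal{G}$ if and only if $\overline{H_1}$ and $\overline{H_2}$ are T-twins in $\overline{\mathcal{G}}$.
   Context: All graphs are finite, undirected, without loops or parallel edges. For a vertex $u$, $\mathcal{N}(u)$ denotes the set of vertices adjacent to $u$ (in the graph under consideration). The complement $\overline{\mathcal{G}}$ of a graph on vertex set $V$ has the same vertex set, with two distinct vertices adjacent iff they are not adjacent in $\mathcal{G}$; for an induced subgraph $H$ of $\mathcal{G}$, $\overline{H}$ is the subgraph of $\overline{\mathcal{G}}$ induced by $V(H)$. Two induced subgraphs $H_1,H_2$ with vertex sets $V_1,V_2$ are F-twins if there is an isomorphism $\varphi:V_1\to V_2$ between them with $\mathcal{N}(u)-V_1=\mathcal{N}(\varphi(u))-V_2$ for all $u\in V_1$, and T-twins if there is an isomorphism $\varphi:V_1\to V_2$ with $\mathcal{N}(u)\cup V_1=\mathcal{N}(\varphi(u))\cup V_2$ for all $u\in V_1$. -}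

module Defs where

open import Data.Nat using (ℕ)
open import Data.Bool using (Bool; true; false; not)
open import Data.Fin using (Fin)
open import Data.Fin.Properties using (_≟_)
open import Data.Fin.Subset using (Subset; _∈_; _∩_; _∪_; ∁)
open import Data.Vec using (tabulate)
open import Data.Product using (Σ; proj₁)
open import Relation.Nullary using (yes; no)
open import Relation.Binary.PropositionalEquality using (_≡_)

record Graph (n : ℕ) : Set where
  field
    adj    : Fin n → Fin n → Bool
    sym    : ∀ u v → adj u v ≡ adj v u
    irrefl : ∀ u → adj u u ≡ false
open Graph public

complement : ∀ {n} → Graph n → Graph n
complement {n} G = record { adj = cadj ; sym = csym ; irrefl = cirr }
  where
  cadj : Fin n → Fin n → Bool
  cadj u v with u ≟ v
  ... | yes _ = false
  ... | no  _ = not (adj G u v)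
  open import Relation.Binary.PropositionalEquality using (refl; cong)
  open import Data.Empty using (⊥-elim)
  csym : ∀ u v → cadj u v ≡ cadj v u
  csym u v with u ≟ v | v ≟ u
  ... | yes _ | yes _ = refl
  ... | yes p | no q = ⊥-elim (q (Relation.Binary.PropositionalEquality.sym p))
  ... | no q | yes p = ⊥-elim (q (Relation.Binary.PropositionalEquality.sym p))
  ... | no _ | no _ = cong not (Graph.sym G u v)
  cirr : ∀ u → cadj u u ≡ false
  cirr u with u ≟ u
  ... | yes _ = refl
  ... | no ¬p = ⊥-elim (¬p refl)

N : ∀ {n} → Graph n → Fin n → Subset n
N G u = tabulate (adj G u)

El : ∀ {n} → Subset n → Set
El {n} V = Σ (Fin n) (λ x → x ∈ V)

record Iso {n} (G : Graph n) (V₁ V₂ : Subset n) : Set where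
  field
    to      : El V₁ → El V₂
    from    : El V₂ → El V₁
    from∘to : ∀ x → proj₁ (from (to x)) ≡ proj₁ x
    to∘from : ∀ y → proj₁ (to (from y)) ≡ proj₁ y
    pres    : ∀ x y → adj G (proj₁ (to x)) (proj₁ (to y)) ≡ adj G (proj₁ x) (proj₁ y)
open Iso public

FTwins : ∀ {n} → Graph n → Subset n → Subset n → Set
FTwins G V₁ V₂ = Σ (Iso G V₁ V₂) λ φ →
  ∀ u → (N G (proj₁ u) ∩ ∁ V₁) ≡ (N G (proj₁ (to φ u)) ∩ ∁ V₂)

TTwins : ∀ {n} → Graph n → Subset n → Subset n → Set
TTwins G V₁ V₂ = Σ (Iso G V₁ V₂) λ φ →
  ∀ u → (N G (proj₁ u) ∪ V₁) ≡ (N G (proj₁ (to φ u)) ∪ V₂)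

-- In the complement, the neighbourhood of u is the complement of the closed
-- neighbourhood N(u) ∪ {u}. So for u ∈ V the part of its neighbourhood outside
-- V in the complement is the complement of N(u) ∪ V, and the conditions
-- N(u) ∪ V₁ = N(φ u) ∪ V₂ and N̄(u) − V₁ = N̄(φ u) − V₂ are equivalent. An
-- isomorphism of induced subgraphs is injective, so it also preserves
-- non-adjacency of distinct vertices and is an isomorphism of the complements.
-- The second equivalence is the first one applied to the complement, whose own
-- complement has the adjacency of G.
module Submission where

open import Defs hiding (sym)
open import Data.Nat using (ℕ)
open import Data.Bool using (false; not; _∧_; _∨_)
open import Data.Bool.Properties using (not-involutive; ∨-∧-booleanAlgebra)
open import Data.Fin using (Fin)
open import Data.Fin.Properties using (_≟_)
open import Data.Fin.Subset using (Subset; _∈_; _∩_; _∪_; ∁)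
open import Data.Fin.Subset.Properties using (∪-∩-booleanAlgebra)
open import Algebra.Lattice.Properties.BooleanAlgebra as BooleanAlgebraProperties using ()
open import Data.Vec using (Vec; lookup; tabulate)
open import Data.Vec.Properties
  using ([]=⇒lookup; lookup-map; lookup-zipWith; lookup∘tabulate; tabulate∘lookup; tabulate-cong)
open import Data.Vec.Properties.WithK using ([]=-irrelevant)
open import Data.Product using (_×_; _,_; proj₁; proj₂)
open import Data.Empty using (⊥-elim)
open import Function.Bundles using (_⇔_; mk⇔)
open import Function using (_∘_)
open import Function.Properties.Equivalence using () renaming (trans to ⇔-trans; sym to ⇔-sym)
open import Relation.Nullary using (Dec; yes; no)
open import Relation.Binary.PropositionalEquality
  using (_≡_; _≢_; refl; sym; trans; cong; cong₂; module ≡-Reasoning)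

open ≡-Reasoning

private
  variable
    A : Set
    n : ℕ
    G H : Graph n
    V V₁ V₂ : Subset n
    u v : Fin n

lookup-ext : {xs ys : Vec A n} → (∀ i → lookup xs i ≡ lookup ys i) → xs ≡ ys
lookup-ext {xs = xs} {ys} same = begin
  xs                   ≡⟨ tabulate∘lookup xs ⟨
  tabulate (lookup xs) ≡⟨ tabulate-cong same ⟩
  tabulate (lookup ys) ≡⟨ tabulate∘lookup ys ⟩
  ys                   ∎

∁-injective : {p q : Subset n} → ∁ p ≡ ∁ q → p ≡ q
∁-injective {n} {p} {q} e = begin
  p       ≡⟨ ¬-involutive p ⟨
  ∁ (∁ p) ≡⟨ cong ∁ e ⟩
  ∁ (∁ q) ≡⟨ ¬-involutive q ⟩
  q       ∎
  where open BooleanAlgebraProperties (∪-∩-booleanAlgebra n) using (¬-involutive)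

El-≡ : (x y : El V) → proj₁ x ≡ proj₁ y → x ≡ y
El-≡ (x , x∈V) (.x , x∈V′) refl = cong (x ,_) ([]=-irrelevant x∈V x∈V′)

to-injective : (φ : Iso G V₁ V₂) (x y : El V₁) →
               proj₁ (to φ x) ≡ proj₁ (to φ y) → proj₁ x ≡ proj₁ y
to-injective φ x y e = begin
  proj₁ x                  ≡⟨ from∘to φ x ⟨
  proj₁ (from φ (to φ x))  ≡⟨ cong (λ z → proj₁ (from φ z)) (El-≡ (to φ x) (to φ y) e) ⟩
  proj₁ (from φ (to φ y))  ≡⟨ from∘to φ y ⟩
  proj₁ y                  ∎

adj-complement-≡ : u ≡ v → adj (complement G) u v ≡ false
adj-complement-≡ {u = u} {v} u≡v with u ≟ v
... | yes _   = refl
... | no  u≢v = ⊥-elim (u≢v u≡v)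

adj-complement-≢ : u ≢ v → adj (complement G) u v ≡ not (adj G u v)
adj-complement-≢ {u = u} {v} u≢v with u ≟ v
... | yes u≡v = ⊥-elim (u≢v u≡v)
... | no  _   = refl

SameAdj : Graph n → Graph n → Set
SameAdj G H = ∀ u v → adj G u v ≡ adj H u v

complement-involutive : (G : Graph n) → SameAdj (complement (complement G)) G
complement-involutive G u v = by-cases (u ≟ v)
  where
  by-cases : Dec (u ≡ v) → adj (complement (complement G)) u v ≡ adj G u v
  by-cases (yes refl) = trans (adj-complement-≡ {u = u} {G = complement G} refl) (sym (irrefl G u))
  by-cases (no u≢v)   = trans (adj-complement-≢ {G = complement G} u≢v)
                          (trans (cong not (adj-complement-≢ {G = G} u≢v)) (not-involutive _))

Iso-respects-SameAdj : SameAdj G H → Iso G V₁ V₂ → Iso H V₁ V₂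
Iso-respects-SameAdj same φ = record
  { to = to φ ; from = from φ ; from∘to = from∘to φ ; to∘from = to∘from φ
  ; pres = λ x y → trans (sym (same _ _)) (trans (pres φ x y) (same _ _))
  }

FTwins-respects-SameAdj : SameAdj G H → FTwins G V₁ V₂ → FTwins H V₁ V₂
FTwins-respects-SameAdj {G = G} {H} {V₁} {V₂} same (φ , exterior) =
  Iso-respects-SameAdj same φ , λ x → begin
    N H (proj₁ x) ∩ ∁ V₁          ≡⟨ cong (_∩ ∁ V₁) (N-same (proj₁ x)) ⟨
    N G (proj₁ x) ∩ ∁ V₁          ≡⟨ exterior x ⟩
    N G (proj₁ (to φ x)) ∩ ∁ V₂   ≡⟨ cong (_∩ ∁ V₂) (N-same (proj₁ (to φ x))) ⟩
    N H (proj₁ (to φ x)) ∩ ∁ V₂   ∎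
  where
  N-same : ∀ u → N G u ≡ N H u
  N-same u = tabulate-cong (same u)

Iso-complement : Iso G V₁ V₂ → Iso (complement G) V₁ V₂
Iso-complement {G = G} φ = record
  { to = to φ ; from = from φ ; from∘to = from∘to φ ; to∘from = to∘from φ
  ; pres = λ x y → pres-complement x y (proj₁ x ≟ proj₁ y)
  }
  where
  pres-complement : ∀ x y → Dec (proj₁ x ≡ proj₁ y) →
    adj (complement G) (proj₁ (to φ x)) (proj₁ (to φ y)) ≡ adj (complement G) (proj₁ x) (proj₁ y)
  pres-complement x y (yes x≡y) = trans (adj-complement-≡ {G = G} (cong (proj₁ ∘ to φ) (El-≡ x y x≡y)))
                                        (sym (adj-complement-≡ {G = G} x≡y))
  pres-complement x y (no x≢y)  = trans (adj-complement-≢ {G = G} (x≢y ∘ to-injective φ x y))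
                                        (trans (cong not (pres φ x y)) (sym (adj-complement-≢ {G = G} x≢y)))

Iso-uncomplement : Iso (complement G) V₁ V₂ → Iso G V₁ V₂
Iso-uncomplement {G = G} φ =
  Iso-respects-SameAdj (complement-involutive G) (Iso-complement φ)

-- N (complement G) u and ∁ (N G u) differ only at u itself, which ∩ ∁ V
-- discards since u ∈ V.
N-complement-∩-∁ : (G : Graph n) → u ∈ V → N (complement G) u ∩ ∁ V ≡ ∁ (N G u ∪ V)
N-complement-∩-∁ {u = u} {V} G u∈V = lookup-ext λ w → begin
  lookup (N (complement G) u ∩ ∁ V) w                   ≡⟨ lookup-zipWith _∧_ w (N (complement G) u) (∁ V) ⟩
  lookup (N (complement G) u) w ∧ lookup (∁ V) w        ≡⟨ cong₂ _∧_ (lookup∘tabulate (adj (complement G) u) w) (lookup-map w not V) ⟩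
  adj (complement G) u w ∧ not (lookup V w)             ≡⟨ pointwise w ⟩
  not (adj G u w ∨ lookup V w)                          ≡⟨ cong not (cong (_∨ lookup V w) (lookup∘tabulate (adj G u) w)) ⟨
  not (lookup (N G u) w ∨ lookup V w)                   ≡⟨ cong not (lookup-zipWith _∨_ w (N G u) V) ⟨
  not (lookup (N G u ∪ V) w)                            ≡⟨ lookup-map w not (N G u ∪ V) ⟨
  lookup (∁ (N G u ∪ V)) w                              ∎
  where
  pointwise : ∀ w → adj (complement G) u w ∧ not (lookup V w) ≡ not (adj G u w ∨ lookup V w)
  pointwise w = by-cases (u ≟ w)
    where
    by-cases : Dec (u ≡ w) → adj (complement G) u w ∧ not (lookup V w) ≡ not (adj G u w ∨ lookup V w)
    by-cases (yes refl) rewrite []=⇒lookup u∈V | adj-complement-≡ {u = u} {G = G} refl | irrefl G u = refl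
    by-cases (no u≢w)   rewrite adj-complement-≢ {G = G} u≢w = sym (deMorgan₂ (adj G u w) (lookup V w))
      where open BooleanAlgebraProperties ∨-∧-booleanAlgebra using (deMorgan₂)

TTwins⇔FTwins-complement : (G : Graph n) → TTwins G V₁ V₂ ⇔ FTwins (complement G) V₁ V₂
TTwins⇔FTwins-complement {V₁ = V₁} {V₂} G = mk⇔ TTwins⇒FTwins FTwins⇒TTwins
  where
  TTwins⇒FTwins : TTwins G V₁ V₂ → FTwins (complement G) V₁ V₂
  TTwins⇒FTwins (φ , closed) = Iso-complement φ , λ x → begin
    N (complement G) (proj₁ x) ∩ ∁ V₁         ≡⟨ N-complement-∩-∁ G (proj₂ x) ⟩
    ∁ (N G (proj₁ x) ∪ V₁)                    ≡⟨ cong ∁ (closed x) ⟩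
    ∁ (N G (proj₁ (to φ x)) ∪ V₂)             ≡⟨ N-complement-∩-∁ G (proj₂ (to φ x)) ⟨
    N (complement G) (proj₁ (to φ x)) ∩ ∁ V₂  ∎

  FTwins⇒TTwins : FTwins (complement G) V₁ V₂ → TTwins G V₁ V₂
  FTwins⇒TTwins (φ , exterior) = Iso-uncomplement φ , λ x → ∁-injective (begin
    ∁ (N G (proj₁ x) ∪ V₁)                    ≡⟨ N-complement-∩-∁ G (proj₂ x) ⟨
    N (complement G) (proj₁ x) ∩ ∁ V₁         ≡⟨ exterior x ⟩
    N (complement G) (proj₁ (to φ x)) ∩ ∁ V₂  ≡⟨ N-complement-∩-∁ G (proj₂ (to φ x)) ⟩
    ∁ (N G (proj₁ (to φ x)) ∪ V₂)             ∎)

FTwins⇔TTwins-complement : (G : Graph n) → FTwins G V₁ V₂ ⇔ TTwins (complement G) V₁ V₂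
FTwins⇔TTwins-complement G = ⇔-trans
  (mk⇔ (FTwins-respects-SameAdj (λ u v → sym (complement-involutive G u v)))
       (FTwins-respects-SameAdj (complement-involutive G)))
  (⇔-sym (TTwins⇔FTwins-complement (complement G)))

theorem2 : (n : ℕ) (G : Graph n) (V₁ V₂ : Subset n) →
    (TTwins G V₁ V₂ ⇔ FTwins (complement G) V₁ V₂) ×
    (FTwins G V₁ V₂ ⇔ TTwins (complement G) V₁ V₂)
theorem2 n G V₁ V₂ = TTwins⇔FTwins-complement G , FTwins⇔TTwins-complement G
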